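{- Let $(D,r)$ be a rooted digraph reduced with respect to Rules 1–4, and let $D_c$ be the contracted graph of $D$. Then every cut-edge of $D_c$ is branching (in $D_c$).
   Context: A rooted digraph $(D,r)$ is a finite digraph without loops or parallel arcs with a root $r$ of in-degree $0$. A cut-vertex is a vertex $v\ne r$ such that some vertex is unreachable from $r$ in $D-v$. A cut-edge is an arc $e$ such that some vertex is unreachable from the root in the digraph minus $e$; a cut-edge $(u,v)$ is lonely if no other cut-edge has tail $u$, and branching otherwise. Contracting an arc $(a,b)$ means identifying $a,b$ into a new vertex, replacing $a,b$ by it in all arcs, and deleting loops and parallel arcs. The contracted graph $D_c$ is obtained from $D$ by contracting all lonely cut-edges of $D$ (its root is the vertex containing $r$); cut-edges and branching cut-edges of $D_c$ are defined with respect to $D_c$ and its root. $N^-(x),N^+(x)$ denote in-/out-neighbourhoods. $D$ is reduced with respect to Rules 1–4 if: (1) every vertex is reachable from $r$; (2) no cut-vertex has exactly one incoming arc and no cut-vertex has exactly one outgoing arc; (3) there are no vertices $u_1,\dots,u_5$ with $N^+(u_i)=N^-(u_i)=\{u_{i-1},u_{i+1}\}$ for $i=2,3,4$; (4) there is no vertex $x$ with an in-neighbour $y$ such that every directed path from $r$ to $y$ contains a vertex of $N^-(x)\setminus\{y\}$. -}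

module Defs where

open import Data.Nat using (ℕ)
open import Data.Fin using (Fin)
open import Data.Bool using (Bool; true; false)
open import Data.List using (List; []; _∷_)
open import Data.List.Membership.Propositional using (_∈_)
open import Data.List.Relation.Unary.Unique.Propositional using (Unique)
open import Data.Product using (Σ; ∃; _×_; _,_)
open import Data.Sum using (_⊎_)
open import Relation.Nullary using (¬_)
open import Relation.Binary.PropositionalEquality using (_≡_; _≢_)
open import Relation.Binary.Construct.Closure.ReflexiveTransitive using (Star)
open import Relation.Binary.Construct.Closure.Equivalence using (EqClosure)

record RootedDigraph : Set where
  field
    n     : ℕ
    adj   : Fin n → Fin n → Bool
    root  : Fin n
    no-loops   : ∀ v → adj v v ≡ false
    root-indeg : ∀ v → adj v root ≡ false

  Arc : Fin n → Fin n → Set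
  Arc u v = adj u v ≡ true

-- Generic notions for a rooted digraph whose vertices are given up to
-- an equivalence _≈_ (for D itself _≈_ is _≡_; for the contracted graph
-- D_c the vertices are the classes of the contraction equivalence).

module CutEdges {V : Set} (_≈_ : V → V → Set) (Arc : V → V → Set) (r : V) where

  ArcMinus : V → V → V → V → Set
  ArcMinus a b p q = Arc p q × ¬ (p ≈ a × q ≈ b)

  StepMinus : V → V → V → V → Set
  StepMinus a b p q = p ≈ q ⊎ ArcMinus a b p q

  CutEdge : V → V → Set
  CutEdge a b = Arc a b × ∃ λ z → ¬ Star (StepMinus a b) r z

  Lonely : V → V → Set
  Lonely a b = CutEdge a b × (∀ c → CutEdge a c → c ≈ b)

  Branching : V → V → Set
  Branching a b = CutEdge a b × ∃ λ c → CutEdge a c × ¬ (c ≈ b)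

module _ (D : RootedDigraph) where
  open RootedDigraph D

  data Walk : Fin n → Fin n → Set where
    [_]  : ∀ v → Walk v v
    _∷ʷ_ : ∀ {u v w} → Arc u v → Walk v w → Walk u w

  walkVertices : ∀ {u w} → Walk u w → List (Fin n)
  walkVertices [ v ] = v ∷ []
  walkVertices (_∷ʷ_ {u} _ p) = u ∷ walkVertices p

  IsPath : ∀ {u w} → Walk u w → Set
  IsPath p = Unique (walkVertices p)

  Reachable : Fin n → Set
  Reachable z = Star Arc root z

  ArcAvoiding : Fin n → Fin n → Fin n → Set
  ArcAvoiding v p q = Arc p q × p ≢ v × q ≢ v

  CutVertex : Fin n → Set
  CutVertex v = v ≢ root × ∃ λ z → z ≢ v × ¬ Star (ArcAvoiding v) root z

  ExactlyOneIn : Fin n → Set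
  ExactlyOneIn v = ∃ λ y → Arc y v × (∀ y′ → Arc y′ v → y′ ≡ y)

  ExactlyOneOut : Fin n → Set
  ExactlyOneOut v = ∃ λ y → Arc v y × (∀ y′ → Arc v y′ → y′ ≡ y)

  BothNbhdsAre : Fin n → Fin n → Fin n → Set
  BothNbhdsAre u a b =
    (∀ w → Arc u w → (w ≡ a ⊎ w ≡ b)) × Arc u a × Arc u b ×
    (∀ w → Arc w u → (w ≡ a ⊎ w ≡ b)) × Arc a u × Arc b u

  Distinct5 : Fin n → Fin n → Fin n → Fin n → Fin n → Set
  Distinct5 u₁ u₂ u₃ u₄ u₅ =
    u₁ ≢ u₂ × u₁ ≢ u₃ × u₁ ≢ u₄ × u₁ ≢ u₅ × u₂ ≢ u₃ × u₂ ≢ u₄ × u₂ ≢ u₅ ×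
    u₃ ≢ u₄ × u₃ ≢ u₅ × u₄ ≢ u₅

  Rule1 : Set
  Rule1 = ∀ z → Reachable z

  Rule2 : Set
  Rule2 = ∀ v → CutVertex v → ¬ ExactlyOneIn v × ¬ ExactlyOneOut v

  Rule3 : Set
  Rule3 = ∀ u₁ u₂ u₃ u₄ u₅ → Distinct5 u₁ u₂ u₃ u₄ u₅ →
    ¬ (BothNbhdsAre u₂ u₁ u₃ × BothNbhdsAre u₃ u₂ u₄ × BothNbhdsAre u₄ u₃ u₅)

  Rule4 : Set
  Rule4 = ¬ (∃ λ x → ∃ λ y → Arc y x ×
            (∀ (p : Walk root y) → IsPath p →
               ∃ λ w → w ∈ walkVertices p × Arc w x × w ≢ y))

  Reduced : Set
  Reduced = Rule1 × Rule2 × Rule3 × Rule4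

  open CutEdges {Fin n} _≡_ Arc root public
    renaming (CutEdge to CutEdgeD; Lonely to LonelyD; Branching to BranchingD;
              ArcMinus to ArcMinusD; StepMinus to StepMinusD)

  -- The contracted graph D_c: contract all lonely cut-edges of D.
  -- Its vertices are the classes of the equivalence relation _∼_
  -- generated by the lonely cut-edges (represented by vertices of D);
  -- there is an arc from class [a] to class [b] iff [a] ≠ [b] and some
  -- arc of D goes from [a] to [b] (loops and parallel arcs deleted).

  _∼_ : Fin n → Fin n → Set
  _∼_ = EqClosure LonelyD

  ArcC : Fin n → Fin n → Set
  ArcC a b = ¬ (a ∼ b) × ∃ λ u → ∃ λ v → a ∼ u × b ∼ v × Arc u v

  open CutEdges {Fin n} _∼_ ArcC root public
    renaming (CutEdge to CutEdgeC; Lonely to LonelyC; Branching to BranchingC;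
              ArcMinus to ArcMinusC; StepMinus to StepMinusC)

module Submission where

-- Idea.  The lonely cut-edges of D form a forest: a vertex has at most one lonely
-- out-edge, and two cut-edges into the same head share their tail.  Hence every
-- contraction class is a tree of lonely cut-edges with a unique top, and the top
-- of a lonely chain lies on every walk from the root to its bottom.  Given a
-- cut-edge (a,b) of D_c, follow a walk from the root to b up to the first arc
-- (x,t) entering the class [b].  Then x ∼ a, t is the top of [b], and (x,t) is a
-- cut-edge of D: another first entry (p,t) would give two in-neighbours of t in
-- one class, one dominating the other along a lonely chain, which Rule 4 forbids.
-- (x,t) is not lonely (else a ∼ b), so x has a second cut-edge (x,w).  A non-lonely
-- cut-edge of D survives contraction, so (a,w) is a cut-edge of D_c, and w ≁ b
-- because w and t are distinct tops.

open import Defs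

open import Data.Nat using (ℕ; zero; suc)
open import Data.Fin using (Fin; punchIn; punchOut)
open import Data.Fin.Properties using (_≟_; punchIn-punchOut; punchOut-cong; any?; all?)
open import Data.Bool using (true)
import Data.Bool.Properties as Bool
open import Data.Product using (∃; ∃₂; _×_; _,_; proj₁; proj₂)
open import Data.Sum using (_⊎_; inj₁; inj₂)
open import Data.Empty using (⊥; ⊥-elim)
open import Data.List.Membership.Propositional using (_∈_)
import Data.List.Membership.DecPropositional as DecMembership
open import Data.List.Relation.Unary.Any using (here; there)
open import Function using (id; flip)
open import Relation.Nullary using (¬_; yes; no)
open import Relation.Nullary.Decidable using (_×-dec_; _⊎-dec_; ¬?; _→-dec_)
open import Relation.Unary using (Decidable)
open import Relation.Binary using (DecidableEquality) renaming (Decidable to Decidable₂)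
open import Relation.Binary.Rewriting using (Deterministic)
open import Relation.Binary.PropositionalEquality
open import Relation.Binary.Construct.Closure.ReflexiveTransitive
open import Relation.Binary.Construct.Closure.Symmetric using (SymClosure; fwd; bwd)
open import Relation.Binary.Construct.Closure.Equivalence using (symmetric)

module Walks {A : Set} where

  Outside : (A → A → Set) → (A → Set) → A → A → Set
  Outside R P s s' = R s s' × ¬ P s'

  NotFrom : (A → A → Set) → A → A → A → Set
  NotFrom R y s s' = R s s' × s ≢ y

  outsideMap : ∀ {R R' : A → A → Set} {P : A → Set} → (∀ {s s'} → R s s' → R' s s') →
    ∀ {u v} → Star (Outside R P) u v → Star (Outside R' P) u v
  outsideMap f = gmap id (λ (r , s'∉P) → f r , s'∉P)

  firstEntry : ∀ {R : A → A → Set} {P : A → Set} → Decidable P →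
    ∀ {u q} → Star R u q → ¬ P u → P q →
    ∃₂ λ p p' → Star (Outside R P) u p × ¬ P p × R p p' × P p'
  firstEntry P? ε u∉P q∈P = ⊥-elim (u∉P q∈P)
  firstEntry P? {u} (_◅_ {j = u'} r rest) u∉P q∈P with P? u'
  ... | yes u'∈P = u , u' , ε , u∉P , r , u'∈P
  ... | no u'∉P with firstEntry P? rest u'∉P q∈P
  ...   | p , p' , prefix , p∉P , r' , p'∈P = p , p' , (r , u'∉P) ◅ prefix , p∉P , r' , p'∈P

  reachesOrAvoids : ∀ {R : A → A → Set} → DecidableEquality A → ∀ y {u v} → Star R u v →
    Star R u y ⊎ Star (NotFrom R y) u v
  reachesOrAvoids _≟ₐ_ y ε = inj₂ ε
  reachesOrAvoids _≟ₐ_ y {u} (r ◅ rest) with u ≟ₐ y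
  ... | yes refl = inj₁ ε
  ... | no u≢y with reachesOrAvoids _≟ₐ_ y rest
  ...   | inj₁ prefix = inj₁ (r ◅ prefix)
  ...   | inj₂ avoiding = inj₂ ((r , u≢y) ◅ avoiding)

  comparable : ∀ {R : A → A → Set} → Deterministic _≡_ R →
    ∀ {q s s'} → Star R q s → Star R q s' → Star R s s' ⊎ Star R s' s
  comparable det ε w' = inj₁ w'
  comparable det (r ◅ w) ε = inj₂ (r ◅ w)
  comparable det (r ◅ w) (r' ◅ w') with det r r'
  ... | refl = comparable det w w'

  noPredecessor⇒empty : ∀ {R : A → A → Set} {s q} → (∀ y → ¬ R y q) → Star R s q → s ≡ q
  noPredecessor⇒empty noPred ε = refl
  noPredecessor⇒empty noPred (r ◅ rest) with noPredecessor⇒empty noPred rest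
  ... | refl = ⊥-elim (noPred _ r)

  outside⇒notFrom : ∀ {R : A → A → Set} {w u v} → u ≢ w →
    Star (Outside R (_≡ w)) u v → Star (NotFrom R w) u v
  outside⇒notFrom u≢w ε = ε
  outside⇒notFrom u≢w ((r , s'≢w) ◅ rest) = (r , u≢w) ◅ outside⇒notFrom s'≢w rest

-- Reachability along a decidable relation on Fin m is decidable, by induction on
-- m: a walk x →* y with x ≢ y has a last departure x → x', after which it lives in
-- the graph with x deleted.
module FiniteReachability where
  open Walks

  module Deletion {m : ℕ} (R : Fin (suc m) → Fin (suc m) → Set) (x : Fin (suc m)) where

    Deleted : Fin m → Fin m → Set
    Deleted i j = R (punchIn x i) (punchIn x j)

    lastDeparture : ∀ {u y} → x ≢ y → Star R u y →
      (x ≢ u × Star (Outside R (x ≡_)) u y) ⊎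
      (∃ λ x' → R x x' × x ≢ x' × Star (Outside R (x ≡_)) x' y)
    lastDeparture x≢y ε = inj₁ (x≢y , ε)
    lastDeparture {u} x≢y (_◅_ {j = u'} r rest) with lastDeparture x≢y rest
    ... | inj₂ departure = inj₂ departure
    ... | inj₁ (x≢u' , avoiding) with x ≟ u
    ...   | yes refl = inj₂ (u' , r , x≢u' , avoiding)
    ...   | no x≢u = inj₁ (x≢u , (r , x≢u') ◅ avoiding)

    toDeleted : ∀ {p q} (x≢p : x ≢ p) (x≢q : x ≢ q) →
      Star (Outside R (x ≡_)) p q → Star Deleted (punchOut x≢p) (punchOut x≢q)
    toDeleted x≢p x≢q ε rewrite punchOut-cong x {i≢j = x≢p} {i≢k = x≢q} refl = ε
    toDeleted x≢p x≢q (_◅_ {j = p'} (r , x≢p') rest) =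
      subst₂ R (sym (punchIn-punchOut x≢p)) (sym (punchIn-punchOut x≢p')) r ◅ toDeleted x≢p' x≢q rest

  reachable? : ∀ {m} (R : Fin m → Fin m → Set) → Decidable₂ R → Decidable₂ (Star R)
  reachable? {zero} R R? ()
  reachable? {suc m} R R? x y with x ≟ y
  ... | yes refl = yes ε
  ... | no x≢y with any? (λ i → R? x (punchIn x i) ×-dec
                   reachable? (Deletion.Deleted R x) (λ i j → R? (punchIn x i) (punchIn x j)) i (punchOut x≢y))
  ...   | yes (i , r , rest) =
          yes (r ◅ subst (Star R (punchIn x i)) (punchIn-punchOut x≢y) (gmap (punchIn x) id rest))
  ...   | no ¬departure = no λ walk → impossible (Deletion.lastDeparture R x x≢y walk)
    where
    impossible : (x ≢ x × Star (Outside R (x ≡_)) x y) ⊎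
                 (∃ λ x' → R x x' × x ≢ x' × Star (Outside R (x ≡_)) x' y) → ⊥
    impossible (inj₁ (x≢x , _)) = x≢x refl
    impossible (inj₂ (x' , r , x≢x' , rest)) =
      ¬departure (punchOut x≢x' , subst (R x) (sym (punchIn-punchOut x≢x')) r ,
                  Deletion.toDeleted R x x≢x' x≢y rest)

module LonelyForest (D : RootedDigraph) (rule1 : Rule1 D) where
  open RootedDigraph D
  open Walks
  open FiniteReachability using (reachable?)
  open DecMembership (_≟_ {n}) using (_∈?_)

  V : Set
  V = Fin n

  Cut : V → V → Set
  Cut = CutEdgeD D

  Lonely : V → V → Set
  Lonely = LonelyD D

  _~_ : V → V → Set
  _~_ = _∼_ D

  ~-sym : ∀ {p q} → p ~ q → q ~ p
  ~-sym = symmetric Lonely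

  lonely⇒~ : ∀ {p q} → Lonely p q → p ~ q
  lonely⇒~ l = fwd l ◅ ε

  arc? : Decidable₂ Arc
  arc? p q = adj p q Bool.≟ true

  cut? : Decidable₂ Cut
  cut? a b = arc? a b ×-dec any? (λ z → ¬? (reachable? (StepMinusD D a b) stepMinus? root z))
    where
    stepMinus? : Decidable₂ (StepMinusD D a b)
    stepMinus? p q = (p ≟ q) ⊎-dec (arc? p q ×-dec ¬? ((p ≟ a) ×-dec (q ≟ b)))

  lonely? : Decidable₂ Lonely
  lonely? a b = cut? a b ×-dec all? (λ c → cut? a c →-dec (c ≟ b))

  _~?_ : Decidable₂ _~_
  _~?_ = reachable? (SymClosure Lonely) symClosure?
    where
    symClosure? : Decidable₂ (SymClosure Lonely)
    symClosure? p q with lonely? p q | lonely? q p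
    ... | yes l | _ = yes (fwd l)
    ... | no _ | yes l = yes (bwd l)
    ... | no ¬l | no ¬l' = no λ { (fwd l) → ¬l l ; (bwd l) → ¬l' l }

  noArcIntoRoot : ∀ {y q} → Arc y q → root ≢ q
  noArcIntoRoot {y} y→q refl with trans (sym y→q) (root-indeg y)
  ... | ()

  noLoop : ∀ {p q} → Arc p q → p ≢ q
  noLoop {p} p→q refl with trans (sym p→q) (no-loops p)
  ... | ()

  -- by Rule 1, a cut-edge cuts off its own head
  headUnreachable : ∀ {a b} → Cut a b → ¬ Star (StepMinusD D a b) root b
  headUnreachable {a} {b} (_ , z , ¬reach-z) reach-b = ¬reach-z (extend (rule1 z) ε)
    where
    extend : ∀ {u v} → Star Arc u v → Star (StepMinusD D a b) root u → Star (StepMinusD D a b) root v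
    extend ε reach-u = reach-u
    extend (_◅_ {i = u} {j = u'} r rest) reach-u with (u ≟ a) ×-dec (u' ≟ b)
    ... | yes (refl , refl) = extend rest reach-b
    ... | no ¬removed = extend rest (reach-u ◅◅ inj₂ (r , ¬removed) ◅ ε)

  arcStepC : ∀ {a b p q} → ¬ (p ~ a × q ~ b) → Arc p q → StepMinusC D a b p q
  arcStepC {p = p} {q} ¬removed p→q with p ~? q
  ... | yes p~q = inj₁ p~q
  ... | no p≁q = inj₂ ((p≁q , p , q , ε , ε , p→q) , ¬removed)

  headUnreachableC : ∀ {a b} → CutEdgeC D a b → ¬ Star (StepMinusC D a b) root b
  headUnreachableC {a} {b} (_ , z , ¬reach-z) reach-b = ¬reach-z (extend (rule1 z) ε)
    where
    extend : ∀ {u v} → Star Arc u v → Star (StepMinusC D a b) root u → Star (StepMinusC D a b) root v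
    extend ε reach-u = reach-u
    extend (_◅_ {i = u} {j = u'} r rest) reach-u with (u ~? a) ×-dec (u' ~? b)
    ... | yes (_ , u'~b) = extend rest (reach-b ◅◅ inj₁ (~-sym u'~b) ◅ ε)
    ... | no ¬removed = extend rest (reach-u ◅◅ arcStepC ¬removed r ◅ ε)

  cutTailOnWalk : ∀ {e₁ e₂ y' y} → Cut y' y →
    Star (StepMinusD D e₁ e₂) root y → Star (StepMinusD D e₁ e₂) root y'
  cutTailOnWalk {e₁} {e₂} {y'} {y} cut reach with reachesOrAvoids _≟_ y' reach
  ... | inj₁ prefix = prefix
  ... | inj₂ avoiding = ⊥-elim (headUnreachable cut (gmap id toMinus avoiding))
    where
    toMinus : ∀ {s s'} → NotFrom (StepMinusD D e₁ e₂) y' s s' → StepMinusD D y' y s s'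
    toMinus (inj₁ s≡s' , _) = inj₁ s≡s'
    toMinus (inj₂ (r , _) , s≢y') = inj₂ (r , λ (s≡y' , _) → s≢y' s≡y')

  chainTopOnWalk : ∀ {e₁ e₂ s y} → Star Lonely s y →
    Star (StepMinusD D e₁ e₂) root y → Star (StepMinusD D e₁ e₂) root s
  chainTopOnWalk ε reach = reach
  chainTopOnWalk (l ◅ rest) reach = cutTailOnWalk (proj₁ l) (chainTopOnWalk rest reach)

  Dominates : V → V → Set
  Dominates y' y = ¬ Star (NotFrom Arc y') root y

  chainDominates : ∀ {y' y} → Star Lonely y' y → y' ≢ y → Dominates y' y
  chainDominates ε y'≢y _ = y'≢y refl
  chainDominates {y'} (_◅_ {j = c} l rest) y'≢y avoiding =
    headUnreachable (proj₁ l) (chainTopOnWalk rest (gmap id toMinus avoiding))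
    where
    toMinus : ∀ {s s'} → NotFrom Arc y' s s' → StepMinusD D y' c s s'
    toMinus (r , s≢y') = inj₂ (r , λ (s≡y' , _) → s≢y' s≡y')

  chainOnWalk : ∀ {y' y} → Star Lonely y' y → y' ≢ y → (W : Walk D root y) → y' ∈ walkVertices D W
  chainOnWalk {y'} chain y'≢y W with y' ∈? walkVertices D W
  ... | yes y'∈W = y'∈W
  ... | no y'∉W = ⊥-elim (chainDominates chain y'≢y (avoid W y'∉W))
    where
    avoid : ∀ {u v} (W : Walk D u v) → ¬ (y' ∈ walkVertices D W) → Star (NotFrom Arc y') u v
    avoid [ v ] _ = ε
    avoid (r ∷ʷ W) y'∉W = (r , λ u≡y' → y'∉W (here (sym u≡y'))) ◅ avoid W (λ m → y'∉W (there m))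

  firstArcInto : ∀ {q} → root ≢ q → ∃ λ p → Star (Outside Arc (_≡ q)) root p × Arc p q
  firstArcInto {q} root≢q with firstEntry (_≟ q) (rule1 q) root≢q refl
  ... | p , _ , prefix , _ , p→q , refl = p , prefix , p→q

  entryTail : ∀ {y q p} → Cut y q → Star (Outside Arc (_≡ q)) root p → Arc p q → p ≡ y
  entryTail {y} {q} {p} cut prefix p→q with p ≟ y
  ... | yes p≡y = p≡y
  ... | no p≢y = ⊥-elim (headUnreachable cut (gmap id toMinus prefix ◅◅ inj₂ (p→q , λ (p≡y , _) → p≢y p≡y) ◅ ε))
    where
    toMinus : ∀ {s s'} → Outside Arc (_≡ q) s s' → StepMinusD D y q s s'
    toMinus (r , s'≢q) = inj₂ (r , λ (_ , s'≡q) → s'≢q s'≡q)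

  cutEdgeTailsEqual : ∀ {y y' q} → Cut y q → Cut y' q → y ≡ y'
  cutEdgeTailsEqual cut cut' with firstArcInto (noArcIntoRoot (proj₁ cut))
  ... | p , prefix , p→q = trans (sym (entryTail cut prefix p→q)) (entryTail cut' prefix p→q)

  -- the forest structure: lonely edges are deterministic forwards and backwards,
  -- so equivalent vertices have a common ancestor along lonely chains
  lonelyDeterministic : Deterministic _≡_ Lonely
  lonelyDeterministic l l' = sym (proj₂ l _ (proj₁ l'))

  lonelyCodeterministic : Deterministic _≡_ (flip Lonely)
  lonelyCodeterministic l l' = cutEdgeTailsEqual (proj₁ l) (proj₁ l')

  commonAncestor : ∀ {p q} → p ~ q → ∃ λ s → Star Lonely s p × Star Lonely s q
  commonAncestor {p} ε = p , ε , ε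
  commonAncestor (bwd l ◅ rest) with commonAncestor rest
  ... | s , s→p' , s→q = s , s→p' ◅◅ l ◅ ε , s→q
  commonAncestor {p} (fwd l ◅ rest) with commonAncestor rest
  ... | s , s→p' , s→q with comparable lonelyCodeterministic (reverse id s→p') (l ◅ ε)
  ...   | inj₁ p→s = p , ε , reverse id p→s ◅◅ s→q
  ...   | inj₂ s→p = s , reverse id s→p , s→q

  Top : V → Set
  Top q = ∀ y → ¬ Lonely y q

  topsEqual : ∀ {t t'} → Top t → Top t' → t ~ t' → t ≡ t'
  topsEqual top top' t~t' with commonAncestor t~t'
  ... | s , s→t , s→t' = trans (sym (noPredecessor⇒empty top s→t)) (noPredecessor⇒empty top' s→t')

  -- Rule 4: an in-neighbour y of t cannot dominate another in-neighbour y' of t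
  -- along a lonely chain, for then every path to y' would meet y
  noChainedInNeighbours : Rule4 D → ∀ {y y' t} → Arc y t → Arc y' t → y ≢ y' → ¬ Star Lonely y y'
  noChainedInNeighbours rule4 {y} {y'} {t} y→t y'→t y≢y' chain =
    rule4 (t , y' , y'→t , λ W _ → y , chainOnWalk chain y≢y' W , y→t , y≢y')

  sameClassInNeighbours : Rule4 D → ∀ {p p' t} → Arc p t → Arc p' t → p ~ p' → p ≡ p'
  sameClassInNeighbours rule4 {p} {p'} p→t p'→t p~p' with p ≟ p'
  ... | yes p≡p' = p≡p'
  ... | no p≢p' with commonAncestor p~p'
  ...   | s , s→p , s→p' with comparable lonelyDeterministic s→p s→p'
  ...     | inj₁ chain = ⊥-elim (noChainedInNeighbours rule4 p→t p'→t p≢p' chain)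
  ...     | inj₂ chain = ⊥-elim (noChainedInNeighbours rule4 p'→t p→t (≢-sym p≢p') chain)

  otherCutEdge : ∀ {x t} → Cut x t → ¬ Lonely x t → ∃ λ w → Cut x w × w ≢ t
  otherCutEdge {x} {t} cut ¬lonely with any? (λ c → cut? x c ×-dec ¬? (c ≟ t))
  ... | yes other = other
  ... | no ¬other = ⊥-elim (¬lonely (cut , onlyT))
    where
    onlyT : ∀ c → Cut x c → c ≡ t
    onlyT c cut-c with c ≟ t
    ... | yes c≡t = c≡t
    ... | no c≢t = ⊥-elim (¬other (c , cut-c , c≢t))

  nonLonelyHeadTop : ∀ {x w} → Cut x w → ¬ Lonely x w → Top w
  nonLonelyHeadTop cut ¬lonely y l with cutEdgeTailsEqual (proj₁ l) cut
  ... | refl = ¬lonely l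

  -- a cut-edge into a top joins two different classes: otherwise its head would
  -- dominate its tail, yet the first entry into the head comes from the tail
  cutIntoTopCrossesClasses : ∀ {x w} → Cut x w → Top w → ¬ (x ~ w)
  cutIntoTopCrossesClasses {x} {w} cut top x~w with commonAncestor x~w
  ... | s , s→x , s→w with noPredecessor⇒empty top s→w
  ...   | refl with firstArcInto (noArcIntoRoot (proj₁ cut))
  ...     | p , prefix , p→w with entryTail cut prefix p→w
  ...       | refl = chainDominates s→x (≢-sym (noLoop (proj₁ cut)))
                       (outside⇒notFrom (noArcIntoRoot (proj₁ cut)) prefix)

  -- if (x,w) is a non-lonely cut-edge, the vertices reachable in D − (x,w) form a
  -- union of classes, and walks of D_c − (a,w) with a ∈ [x] lift to D − (x,w)
  module NonLonely {x w} (¬lonely : ¬ Lonely x w) where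

    ReachMinus : V → Set
    ReachMinus q = Star (StepMinusD D x w) root q

    descend : ∀ {s q} → Star Lonely s q → ReachMinus s → ReachMinus q
    descend ε reach = reach
    descend (_◅_ {i = p} {j = p'} l rest) reach with (p ≟ x) ×-dec (p' ≟ w)
    ... | yes (refl , refl) = ⊥-elim (¬lonely l)
    ... | no ¬removed = descend rest (reach ◅◅ inj₂ (proj₁ (proj₁ l) , ¬removed) ◅ ε)

    classClosed : ∀ {y q} → ReachMinus y → q ~ y → ReachMinus q
    classClosed reach q~y with commonAncestor q~y
    ... | s , s→q , s→y = descend s→q (chainTopOnWalk s→y reach)

    liftC : ∀ {a u p} → x ~ a → Star (StepMinusC D a w) u p →
      (∀ {q} → q ~ u → ReachMinus q) → ∀ {q} → q ~ p → ReachMinus q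
    liftC x~a ε reach-u = reach-u
    liftC x~a (inj₁ u~u' ◅ rest) reach-u = liftC x~a rest (λ q~u' → reach-u (q~u' ◅◅ ~-sym u~u'))
    liftC x~a (inj₂ ((_ , s₁ , s₂ , u~s₁ , u'~s₂ , r) , ¬removed) ◅ rest) reach-u =
      liftC x~a rest (λ q~u' → classClosed reach-s₂ (q~u' ◅◅ u'~s₂))
      where
      reach-s₂ : ReachMinus s₂
      reach-s₂ with (s₁ ≟ x) ×-dec (s₂ ≟ w)
      ... | yes (refl , refl) = ⊥-elim (¬removed (u~s₁ ◅◅ x~a , u'~s₂))
      ... | no ¬removed' = reach-u (~-sym u~s₁) ◅◅ inj₂ (r , ¬removed') ◅ ε

  nonLonelyCutEdgeSurvives : ∀ {a x w} → x ~ a → Cut x w → ¬ Lonely x w → CutEdgeC D a w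
  nonLonelyCutEdgeSurvives {a} {x} {w} x~a cut ¬lonely =
    (a≁w , x , w , ~-sym x~a , ε , proj₁ cut) , w , unreachable
    where
    open NonLonely ¬lonely
    a≁w : ¬ (a ~ w)
    a≁w a~w = cutIntoTopCrossesClasses cut (nonLonelyHeadTop cut ¬lonely) (x~a ◅◅ a~w)
    unreachable : ¬ Star (StepMinusC D a w) root w
    unreachable reach = headUnreachable cut (liftC x~a reach (classClosed ε) ε)

module HeadClass (D : RootedDigraph) (rule1 : Rule1 D) (rule4 : Rule4 D)
                 {a b : Fin (RootedDigraph.n D)} (ce : CutEdgeC D a b) where
  open RootedDigraph D
  open Walks
  open LonelyForest D rule1

  InB : V → Set
  InB q = q ~ b

  a≁b : ¬ (a ~ b)
  a≁b = proj₁ (proj₁ ce)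

  root∉B : ¬ InB root
  root∉B root~b = headUnreachableC ce (inj₁ root~b ◅ ε)

  StepD : V → V → Set
  StepD s s' = s ≡ s' ⊎ Arc s s'

  liftOutsideB : ∀ {u s} → Star (Outside StepD InB) u s →
    Star (StepMinusC D a b) root u → Star (StepMinusC D a b) root s
  liftOutsideB ε reach = reach
  liftOutsideB ((inj₁ refl , _) ◅ rest) reach = liftOutsideB rest reach
  liftOutsideB ((inj₂ r , s'∉B) ◅ rest) reach =
    liftOutsideB rest (reach ◅◅ arcStepC (λ (_ , s'~b) → s'∉B s'~b) r ◅ ε)

  entryTailInA : ∀ {p q} → Star (Outside StepD InB) root p → Arc p q → InB q → p ~ a
  entryTailInA {p} prefix p→q q∈B with p ~? a
  ... | yes p~a = p~a
  ... | no p≁a = ⊥-elim (headUnreachableC ce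
                   (liftOutsideB prefix ε ◅◅ arcStepC (λ (p~a , _) → p≁a p~a) p→q ◅ inj₁ q∈B ◅ ε))

  entryHeadTop : ∀ {p q} → Star (Outside StepD InB) root p → ¬ InB p → Arc p q → InB q → Top q
  entryHeadTop {p} {q} prefix p∉B p→q q∈B y l =
    headUnreachable (proj₁ l) (gmap id toMinus prefix ◅◅ inj₂ (p→q , λ (p≡y , _) → p∉B (subst InB (sym p≡y) y∈B)) ◅ ε)
    where
    y∈B : InB y
    y∈B = lonely⇒~ l ◅◅ q∈B
    toMinus : ∀ {s s'} → Outside StepD InB s s' → StepMinusD D y q s s'
    toMinus (inj₁ s≡s' , _) = inj₁ s≡s'
    toMinus (inj₂ r , s'∉B) = inj₂ (r , λ (_ , s'≡q) → s'∉B (subst InB (sym s'≡q) q∈B))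

  -- a first entry into [b] is a cut-edge: any walk of D − (x,t) to t would enter
  -- [b] through t from another in-neighbour in [a] = [x], against Rule 4
  entryArcIsCut : ∀ {x t} → Star (Outside StepD InB) root x → ¬ InB x → Arc x t → InB t → Cut x t
  entryArcIsCut {x} {t} prefix x∉B x→t t∈B = x→t , t , noOtherEntry
    where
    noOtherEntry : ¬ Star (StepMinusD D x t) root t
    noOtherEntry reach with firstEntry (_~? b) reach root∉B t∈B
    ... | p , q , _ , p∉B , inj₁ p≡q , q∈B = p∉B (subst InB (sym p≡q) q∈B)
    ... | p , q , prefix' , p∉B , inj₂ (p→q , ¬removed) , q∈B = ¬removed (p≡x , q≡t)
      where
      prefixD : Star (Outside StepD InB) root p
      prefixD = outsideMap (λ { (inj₁ s≡s') → inj₁ s≡s' ; (inj₂ (r , _)) → inj₂ r }) prefix'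
      q≡t : q ≡ t
      q≡t = topsEqual (entryHeadTop prefixD p∉B p→q q∈B) (entryHeadTop prefix x∉B x→t t∈B) (q∈B ◅◅ ~-sym t∈B)
      p≡x : p ≡ x
      p≡x = sameClassInNeighbours rule4 (subst (Arc p) q≡t p→q) x→t
              (entryTailInA prefixD p→q q∈B ◅◅ ~-sym (entryTailInA prefix x→t t∈B))

  entryIntoHeadClass : ∃₂ λ x t → x ~ a × InB t × Top t × Cut x t
  entryIntoHeadClass with firstEntry (_~? b) (rule1 b) root∉B ε
  ... | x , t , prefix , x∉B , x→t , t∈B =
    x , t , entryTailInA prefixD x→t t∈B , t∈B , entryHeadTop prefixD x∉B x→t t∈B , entryArcIsCut prefixD x∉B x→t t∈B
    where
    prefixD : Star (Outside StepD InB) root x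
    prefixD = outsideMap inj₂ prefix

lemma26 : (D : RootedDigraph) → Reduced D →
    ∀ (a b : Fin (RootedDigraph.n D)) → CutEdgeC D a b → BranchingC D a b
lemma26 D (rule1 , _ , _ , rule4) a b ce =
  let
      (x , t , x~a , t~b , top-t , cut-xt) = entryIntoHeadClass
      -- it is not lonely, for then a ∼ x ∼ t ∼ b; so x has another cut-edge (x,w)
      (w , cut-xw , w≢t) = otherCutEdge cut-xt (λ l → a≁b (~-sym x~a ◅◅ lonely⇒~ l ◅◅ t~b))
      -- (x,w) is not lonely either, since (x,t) also leaves x
      ¬lonely-xw : ¬ Lonely x w
      ¬lonely-xw = λ l → w≢t (sym (proj₂ l t cut-xt))
  in ce , w , nonLonelyCutEdgeSurvives x~a cut-xw ¬lonely-xw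
   , λ w~b → w≢t (topsEqual (nonLonelyHeadTop cut-xw ¬lonely-xw) top-t (w~b ◅◅ ~-sym t~b))
  where
  open LonelyForest D rule1
  open HeadClass D rule1 rule4 ce
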